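{- Let $(a_n)_{n\ge1}$ be the sequence defined by $a_n=\max\{k\ge1: t_{n,2k}>0\}$, where $t_{n,m}$ is the number of growing binary trees with $n$ internal nodes and $m$ anchors, and for $n\ge1$ let $b_n=\#\{k\ge1 : a_k=n\}$. Then \[ b_n=\begin{cases} p+2 & \text{if } n=2^p,\\ p+1 & \text{if } n=2^p a \text{ with } a>1 \text{ odd}.\end{cases}\] In particular, $b_1=2$, $b_{2n}=b_n+1$ for all $n\ge1$, and $b_{2n+1}=1$ for all $n\ge1$.
   Context: Growing binary trees are plane (ordered) binary trees whose nodes are of three types: internal nodes, anchors (active leaves) and dead leaves. They are produced by the following growth process: at time $t=0$ the tree consists of a single anchor; at each time $t=1,2,\dots$, every anchor is simultaneously replaced either by a dead leaf or by an internal node with two anchors as children. A growing binary tree is any tree obtainable after finitely many steps of this process. $t_{n,m}$ counts distinct such trees with $n$ internal nodes and $m$ anchors. (The sequence $(a_n)$ is nondecreasing, with consecutive terms differing by $0$ or $1$, and $a_1=1$.) -}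

module Defs where

open import Data.Nat using (ℕ; zero; suc; _+_; _*_; _≤_)
open import Data.Product using (Σ; ∃; ∃-syntax; _×_; _,_)
open import Data.List using (List; length)
open import Data.List.Membership.Propositional using (_∈_)
open import Data.List.Relation.Unary.Unique.Propositional using (Unique)
open import Relation.Binary.PropositionalEquality using (_≡_)

data GTree : Set where
  anchor : GTree
  dead   : GTree
  node   : GTree → GTree → GTree

internal : GTree → ℕ
internal anchor     = 0
internal dead       = 0
internal (node l r) = suc (internal l + internal r)

anchors : GTree → ℕ
anchors anchor     = 1
anchors dead       = 0
anchors (node l r) = anchors l + anchors r

data Step : GTree → GTree → Set where
  anchor→dead : Step anchor dead
  anchor→node : Step anchor (node anchor anchor)
  dead→dead   : Step dead dead
  node→node   : ∀ {l r l′ r′} → Step l l′ → Step r r′ → Step (node l r) (node l′ r′)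

data Reach : ℕ → GTree → Set where
  start : Reach 0 anchor
  grow  : ∀ {t T T′} → Reach t T → Step T T′ → Reach (suc t) T′

Growing : GTree → Set
Growing T = ∃[ t ] Reach t T

-- t_{n,m} > 0
TPos : ℕ → ℕ → Set
TPos n m = ∃[ T ] (Growing T × internal T ≡ n × anchors T ≡ m)

-- A n k  :  a_n = k,  i.e.  k = max { k ≥ 1 : t_{n,2k} > 0 }
A : ℕ → ℕ → Set
A n k = (1 ≤ k) × TPos n (2 * k) × (∀ j → 1 ≤ j → TPos n (2 * j) → j ≤ k)

-- B n v  :  b_n = v,  i.e.  the set { k ≥ 1 : a_k = n } is finite with exactly v elements
B : ℕ → ℕ → Set
B n v = ∃[ xs ] (length xs ≡ v × Unique xs ×
          (∀ k → (k ∈ xs → (1 ≤ k × A k n)) × ((1 ≤ k × A k n) → k ∈ xs)))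

-- A step that activates j anchors of a tree yields 2j anchors and j new internal
-- nodes.  If the tree had 2k anchors then j ≤ 2k, so ⌈j/2⌉ ≤ k; hence a growing
-- tree with 2k anchors (k ≥ 1) has at least S k = minInternal k internal nodes,
-- where
--   S 1 = 1,   S k = k + S ⌈k/2⌉  (k ≥ 2),
-- and S k is attained by always activating as few anchors as possible.  Grafting a
-- tree under a new root next to a dead leaf costs one time step and adds exactly one
-- internal node, so every n ≥ S k is attained as well.  Therefore a_n = N exactly
-- when S N ≤ n < S (N + 1), and b_N = S (N + 1) − S N.  Evaluating the recursion:
-- this gap is 2 at N = 1, grows by one from N to 2N, and is 1 at every odd N > 1.
module Submission where

open import Defs
open import Data.List using (applyUpTo)
open import Data.List.Membership.Propositional using (_∈_)
open import Data.List.Membership.Propositional.Properties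
  using (∈-applyUpTo⁺; ∈-applyUpTo⁻)
open import Data.List.Properties using (length-applyUpTo)
open import Data.List.Relation.Unary.Unique.Propositional.Properties
  using (applyUpTo⁺₁)
open import Data.Nat
  using (ℕ; zero; suc; _+_; _*_; _^_; _∸_; _≤_; _<_; z≤n; s≤s; ⌊_/2⌋; ⌈_/2⌉)
open import Data.Nat.Divisibility using (_∣_; _∣0; ∣-refl; ∣m∣n⇒∣m+n)
open import Data.Nat.Induction using (<-wellFounded)
open import Data.Nat.Properties
open import Algebra.Properties.CommutativeSemigroup +-commutativeSemigroup
  using (interchange)
open import Data.Product using (_×_; _,_; ∃-syntax)
open import Function using (_∘_; _⇔_; mk⇔; Equivalence)
open import Induction.WellFounded using (Acc; acc)
open import Relation.Binary.PropositionalEquality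
open import Relation.Nullary using (¬_; contradiction)

open Equivalence using (to; from)

minInternal′ : ∀ k → Acc _<_ k → ℕ
minInternal′ 0             _        = 0
minInternal′ 1             _        = 1
minInternal′ (suc (suc k)) (acc rs) =
  suc (suc k) + minInternal′ (suc ⌈ k /2⌉) (rs (⌈n/2⌉<n k))

minInternal : ℕ → ℕ
minInternal k = minInternal′ k (<-wellFounded k)

minInternal′-acc-irrelevant : ∀ k {acc₁ acc₂} →
                              minInternal′ k acc₁ ≡ minInternal′ k acc₂
minInternal′-acc-irrelevant 0             = refl
minInternal′-acc-irrelevant 1             = refl
minInternal′-acc-irrelevant (suc (suc k)) {acc _} {acc _} =
  cong (suc (suc k) +_) (minInternal′-acc-irrelevant (suc ⌈ k /2⌉))

minInternal-unfold : ∀ k → 2 ≤ k → minInternal k ≡ k + minInternal ⌈ k /2⌉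
minInternal-unfold 1             (s≤s ())
minInternal-unfold (suc (suc k)) _ =
  cong (suc (suc k) +_) (minInternal′-acc-irrelevant (suc ⌈ k /2⌉))

minInternal′-mono-≤ : ∀ {i j acc₁ acc₂} → i ≤ j →
                      minInternal′ i acc₁ ≤ minInternal′ j acc₂
minInternal′-mono-≤ z≤n = z≤n
minInternal′-mono-≤ {1} {1} (s≤s z≤n) = ≤-refl
minInternal′-mono-≤ {1} {suc (suc _)} {acc₂ = acc _} (s≤s z≤n) = s≤s z≤n
minInternal′-mono-≤ {acc₁ = acc _} {acc _} (s≤s (s≤s i≤j)) =
  +-mono-≤ (s≤s (s≤s i≤j)) (minInternal′-mono-≤ (s≤s (⌈n/2⌉-mono i≤j)))

minInternal-mono-≤ : ∀ {i j} → i ≤ j → minInternal i ≤ minInternal j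
minInternal-mono-≤ = minInternal′-mono-≤

⌊2*n/2⌋≡n : ∀ n → ⌊ 2 * n /2⌋ ≡ n
⌊2*n/2⌋≡n n = trans (cong (λ m → ⌊ n + m /2⌋) (+-identityʳ n)) (sym (n≡⌊n+n/2⌋ n))

⌈2*n/2⌉≡n : ∀ n → ⌈ 2 * n /2⌉ ≡ n
⌈2*n/2⌉≡n n = trans (cong (λ m → ⌈ n + m /2⌉) (+-identityʳ n)) (sym (n≡⌈n+n/2⌉ n))

n≤2*⌈n/2⌉ : ∀ n → n ≤ 2 * ⌈ n /2⌉
n≤2*⌈n/2⌉ n = begin
  n                     ≡⟨ ⌊n/2⌋+⌈n/2⌉≡n n ⟨
  ⌊ n /2⌋ + ⌈ n /2⌉     ≤⟨ +-monoˡ-≤ ⌈ n /2⌉ (⌊n/2⌋≤⌈n/2⌉ n) ⟩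
  ⌈ n /2⌉ + ⌈ n /2⌉     ≡⟨ cong (⌈ n /2⌉ +_) (+-identityʳ ⌈ n /2⌉) ⟨
  2 * ⌈ n /2⌉           ∎
  where open ≤-Reasoning

minInternal-≤-half : ∀ {j k} → j ≤ 2 * k → minInternal j ≤ j + minInternal k
minInternal-≤-half {j} {k} j≤2k =
  ≤-trans (≤-unfold j) (+-monoʳ-≤ j (minInternal-mono-≤ ⌈j/2⌉≤k))
  where
  ⌈j/2⌉≤k : ⌈ j /2⌉ ≤ k
  ⌈j/2⌉≤k = subst (⌈ j /2⌉ ≤_) (⌈2*n/2⌉≡n k) (⌈n/2⌉-mono j≤2k)

  ≤-unfold : ∀ j → minInternal j ≤ j + minInternal ⌈ j /2⌉
  ≤-unfold 0             = z≤n
  ≤-unfold 1             = s≤s z≤n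
  ≤-unfold (suc (suc j)) =
    ≤-reflexive (minInternal-unfold (suc (suc j)) (s≤s (s≤s z≤n)))

minInternal-2* : ∀ {N} → 1 ≤ N → minInternal (2 * N) ≡ 2 * N + minInternal N
minInternal-2* {N} 1≤N =
  trans (minInternal-unfold (2 * N) (*-monoʳ-≤ 2 1≤N))
        (cong (λ m → 2 * N + minInternal m) (⌈2*n/2⌉≡n N))

minInternal-1+2* : ∀ {N} → 1 ≤ N →
                   minInternal (suc (2 * N)) ≡ suc (2 * N) + minInternal (suc N)
minInternal-1+2* {N} 1≤N =
  trans (minInternal-unfold (suc (2 * N)) (m≤n⇒m≤1+n (*-monoʳ-≤ 2 1≤N)))
        (cong (λ m → suc (2 * N) + minInternal (suc m)) (⌊2*n/2⌋≡n N))

minInternal-2+2* : ∀ N → minInternal (suc (suc (2 * N))) ≡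
                         suc (suc (2 * N)) + minInternal (suc N)
minInternal-2+2* N =
  trans (minInternal-unfold (suc (suc (2 * N))) (s≤s (s≤s z≤n)))
        (cong (λ m → suc (suc (2 * N)) + minInternal (suc m)) (⌈2*n/2⌉≡n N))

record Grows (j : ℕ) (T T′ : GTree) : Set where
  constructor grows
  field
    anchors-grows  : anchors T′ ≡ 2 * j
    internal-grows : internal T′ ≡ internal T + j

node-grows : ∀ {j₁ j₂ l r l′ r′} → Grows j₁ l l′ → Grows j₂ r r′ →
             Grows (j₁ + j₂) (node l r) (node l′ r′)
node-grows {j₁} {j₂} {l} {r} (grows anchors₁ internal₁) (grows anchors₂ internal₂) =
  grows (trans (cong₂ _+_ anchors₁ anchors₂) (sym (*-distribˡ-+ 2 j₁ j₂)))
    (cong suc (trans (cong₂ _+_ internal₁ internal₂)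
                     (interchange (internal l) j₁ (internal r) j₂)))

step-grows : ∀ {T T′} → Step T T′ → ∃[ j ] j ≤ anchors T × Grows j T T′
step-grows anchor→dead = 0 , z≤n , grows refl refl
step-grows anchor→node = 1 , ≤-refl , grows refl refl
step-grows dead→dead   = 0 , z≤n , grows refl refl
step-grows (node→node sl sr)
  with j₁ , j₁≤ , grows₁ ← step-grows sl | j₂ , j₂≤ , grows₂ ← step-grows sr
  = j₁ + j₂ , +-mono-≤ j₁≤ j₂≤ , node-grows grows₁ grows₂

grows-step : ∀ T {j} → j ≤ anchors T → ∃[ T′ ] Step T T′ × Grows j T T′
grows-step anchor {0}           _         = dead , anchor→dead , grows refl refl
grows-step anchor {1}           _         =
  node anchor anchor , anchor→node , grows refl refl
grows-step anchor {suc (suc _)} (s≤s ())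
grows-step dead                 z≤n       = dead , dead→dead , grows refl refl
grows-step (node l r) {j} j≤
  with l′ , sl , grows₁ ← grows-step l (m⊓n≤m (anchors l) j)
     | r′ , sr , grows₂ ← grows-step r (m≤n+o⇒m∸n≤o j (anchors l) j≤)
  = node l′ r′ , node→node sl sr ,
    subst (λ i → Grows i (node l r) (node l′ r′)) (m⊓n+n∸m≡n (anchors l) j)
          (node-grows grows₁ grows₂)

reach-suc-bound : ∀ {t T} → Reach (suc t) T →
                  ∃[ k ] anchors T ≡ 2 * k × minInternal k ≤ internal T
reach-suc-bound (grow start s)
  with j , j≤1 , grows anchors≡ internal≡ ← step-grows s =
  j , anchors≡ , subst (minInternal j ≤_) (sym internal≡) (≤-self j≤1)
  where
  ≤-self : ∀ {j} → j ≤ 1 → minInternal j ≤ j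
  ≤-self z≤n       = z≤n
  ≤-self (s≤s z≤n) = ≤-refl
reach-suc-bound {T = T′} (grow {T = T} r@(grow _ _) s)
  with k , anchors≡ , bound ← reach-suc-bound r
     | j , j≤ , grows anchors≡′ internal≡′ ← step-grows s
  = j , anchors≡′ , (begin
      minInternal j          ≤⟨ minInternal-≤-half {k = k} (subst (j ≤_) anchors≡ j≤) ⟩
      j + minInternal k      ≤⟨ +-monoʳ-≤ j bound ⟩
      j + internal T         ≡⟨ +-comm j (internal T) ⟩
      internal T + j         ≡⟨ internal≡′ ⟨
      internal T′            ∎)
  where open ≤-Reasoning

TPos⇒minInternal≤ : ∀ {n k} → TPos n (2 * k) → minInternal k ≤ n
TPos⇒minInternal≤ {k = k} (_ , (zero , start) , _ , 1≡2k) =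
  contradiction (sym 1≡2k) (even≢odd k 0)
TPos⇒minInternal≤ {k = k} (T , (suc _ , r) , refl , anchors≡)
  with k′ , anchors≡′ , bound ← reach-suc-bound r
  = subst (λ i → minInternal i ≤ internal T)
          (*-cancelˡ-≡ k′ k 2 (trans (sym anchors≡′) anchors≡)) bound

minimal-tree′ : ∀ k (rec : Acc _<_ k) → 1 ≤ k →
                ∃[ t ] ∃[ T ] Reach (suc t) T ×
                  internal T ≡ minInternal′ k rec × anchors T ≡ 2 * k
minimal-tree′ 1 _ _ = 0 , node anchor anchor , grow start anchor→node , refl , refl
minimal-tree′ (suc (suc k)) (acc rs) _
  with t , T , r , internal≡ , anchors≡
         ← minimal-tree′ (suc ⌈ k /2⌉) (rs (⌈n/2⌉<n k)) (s≤s z≤n)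
  with T′ , s , grows anchors≡′ internal≡′
         ← grows-step T (subst (suc (suc k) ≤_) (sym anchors≡) (n≤2*⌈n/2⌉ (suc (suc k))))
  = suc t , T′ , grow r s ,
    trans internal≡′ (trans (cong (_+ suc (suc k)) internal≡) (+-comm _ (suc (suc k)))) ,
    anchors≡′

minimal-tree : ∀ {k} → 1 ≤ k → ∃[ t ] ∃[ T ] Reach (suc t) T ×
                 internal T ≡ minInternal k × anchors T ≡ 2 * k
minimal-tree {k} = minimal-tree′ k (<-wellFounded k)

reach-node-dead : ∀ {t T} → Reach (suc t) T → Reach (suc (suc t)) (node T dead)
reach-node-dead (grow start s)        =
  grow (grow start anchor→node) (node→node s anchor→dead)
reach-node-dead (grow r@(grow _ _) s) =
  grow (reach-node-dead r) (node→node s dead→dead)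

pad : ∀ d {t T} → Reach (suc t) T → ∃[ T′ ] Reach (suc (d + t)) T′ ×
      internal T′ ≡ d + internal T × anchors T′ ≡ anchors T
pad zero    {T = T} r = T , r , refl , refl
pad (suc d) r with T′ , r′ , internal≡ , anchors≡ ← pad d r =
  node T′ dead , reach-node-dead r′ ,
  cong suc (trans (+-identityʳ _) internal≡) , trans (+-identityʳ _) anchors≡

minInternal≤⇒TPos : ∀ {n k} → 1 ≤ k → minInternal k ≤ n → TPos n (2 * k)
minInternal≤⇒TPos {n} {k} 1≤k bound
  with _ , T , r , internal≡ , anchors≡ ← minimal-tree 1≤k
  with T′ , r′ , internal≡′ , anchors≡′ ← pad (n ∸ minInternal k) r
  = T′ , (_ , r′) ,
    trans internal≡′ (trans (cong (n ∸ minInternal k +_) internal≡) (m∸n+n≡m bound)) ,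
    trans anchors≡′ anchors≡

A-interval : ∀ {N k} → 1 ≤ N →
             (1 ≤ k × A k N) ⇔ (minInternal N ≤ k × k < minInternal (suc N))
A-interval {N} {k} 1≤N = mk⇔ bounds maximal
  where
  bounds : 1 ≤ k × A k N → minInternal N ≤ k × k < minInternal (suc N)
  bounds (_ , _ , tpos , max) =
    TPos⇒minInternal≤ {k = N} tpos ,
    ≰⇒> λ bound →
      1+n≰n (max (suc N) (s≤s z≤n) (minInternal≤⇒TPos (s≤s z≤n) bound))

  maximal : minInternal N ≤ k × k < minInternal (suc N) → 1 ≤ k × A k N
  maximal (lower , upper) =
    ≤-trans (minInternal-mono-≤ 1≤N) lower , 1≤N , minInternal≤⇒TPos 1≤N lower ,
    λ j _ tpos → ≮⇒≥ (λ N<j →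
      <⇒≱ upper (≤-trans (minInternal-mono-≤ N<j)
                         (TPos⇒minInternal≤ {k = j} tpos)))

∈-applyUpTo-+ : ∀ s v {k} → k ∈ applyUpTo (s +_) v ⇔ (s ≤ k × k < s + v)
∈-applyUpTo-+ s v {k} = mk⇔ bounds member
  where
  bounds : k ∈ applyUpTo (s +_) v → s ≤ k × k < s + v
  bounds k∈ with i , i<v , refl ← ∈-applyUpTo⁻ (s +_) k∈ =
    m≤m+n s i , +-monoʳ-< s i<v

  member : s ≤ k × k < s + v → k ∈ applyUpTo (s +_) v
  member (s≤k , k<s+v) = subst (_∈ applyUpTo (s +_) v) (m+[n∸m]≡n s≤k)
    (∈-applyUpTo⁺ (s +_) (+-cancelˡ-< s (k ∸ s) v
      (subst (_< s + v) (sym (m+[n∸m]≡n s≤k)) k<s+v)))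

B-interval : ∀ {N} s v → (∀ k → (1 ≤ k × A k N) ⇔ (s ≤ k × k < s + v)) → B N v
B-interval s v A⇔ =
  applyUpTo (s +_) v , length-applyUpTo (s +_) v ,
  applyUpTo⁺₁ (s +_) v (λ i<j _ → <⇒≢ (+-monoʳ-< s i<j)) ,
  λ k → from (A⇔ k) ∘ to (∈-applyUpTo-+ s v) ,
        from (∈-applyUpTo-+ s v) ∘ to (A⇔ k)

Jump : ℕ → ℕ → Set
Jump N v = minInternal (suc N) ≡ minInternal N + v

Jump⇒B : ∀ {N v} → 1 ≤ N → Jump N v → B N v
Jump⇒B {N} {v} 1≤N jump = B-interval (minInternal N) v λ k →
  subst (λ u → (1 ≤ k × A k N) ⇔ (minInternal N ≤ k × k < u)) jump (A-interval 1≤N)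

Jump-double : ∀ {N v} → 1 ≤ N → Jump N v → Jump (2 * N) (suc v)
Jump-double {N} {v} 1≤N jump = begin
  minInternal (suc (2 * N))          ≡⟨ minInternal-1+2* 1≤N ⟩
  suc (2 * N) + minInternal (suc N)  ≡⟨ cong (suc (2 * N) +_) jump ⟩
  suc (2 * N) + (minInternal N + v)  ≡⟨ cong suc (+-assoc (2 * N) (minInternal N) v) ⟨
  suc (2 * N + minInternal N + v)    ≡⟨ +-suc (2 * N + minInternal N) v ⟨
  2 * N + minInternal N + suc v      ≡⟨ cong (_+ suc v) (minInternal-2* 1≤N) ⟨
  minInternal (2 * N) + suc v        ∎
  where open ≡-Reasoning

Jump-odd : ∀ {N} → 1 ≤ N → Jump (suc (2 * N)) 1
Jump-odd {N} 1≤N = begin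
  minInternal (suc (suc (2 * N)))          ≡⟨ minInternal-2+2* N ⟩
  suc (suc (2 * N)) + minInternal (suc N)  ≡⟨ +-comm 1 _ ⟩
  suc (2 * N) + minInternal (suc N) + 1    ≡⟨ cong (_+ 1) (minInternal-1+2* 1≤N) ⟨
  minInternal (suc (2 * N)) + 1            ∎
  where open ≡-Reasoning

odd⇒1+2* : ∀ {a} → ¬ 2 ∣ a → ∃[ h ] a ≡ suc (2 * h)
odd⇒1+2* {zero}        2∤0 = contradiction (2 ∣0) 2∤0
odd⇒1+2* {suc zero}    _   = 0 , refl
odd⇒1+2* {suc (suc a)} 2∤a+2 with h , refl ← odd⇒1+2* (2∤a+2 ∘ ∣m∣n⇒∣m+n ∣-refl)
  = suc h , cong (suc ∘ suc) (sym (+-suc h (h + 0)))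

Jump-2^p : ∀ p → Jump (2 ^ p) (p + 2)
Jump-2^p zero    = refl
Jump-2^p (suc p) = Jump-double (m^n>0 2 p) (Jump-2^p p)

Jump-2^p*odd : ∀ p {a} → ¬ 2 ∣ a → 1 < a → Jump (2 ^ p * a) (p + 1)
Jump-2^p*odd zero {a} 2∤a 1<a with odd⇒1+2* 2∤a
... | zero  , refl = contradiction 1<a (<-irrefl refl)
... | suc h , refl =
  subst (λ m → Jump m 1) (sym (*-identityˡ a)) (Jump-odd {suc h} (s≤s z≤n))
Jump-2^p*odd (suc p) {a} 2∤a 1<a =
  subst (λ m → Jump m (suc p + 1)) (sym (*-assoc 2 (2 ^ p) a))
    (Jump-double (*-mono-≤ (m^n>0 2 p) (<⇒≤ 1<a)) (Jump-2^p*odd p 2∤a 1<a))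

proposition3p2 : ((p : ℕ) → B (2 ^ p) (p + 2))
    × ((p a : ℕ) → ¬ (2 ∣ a) → 1 < a → B (2 ^ p * a) (p + 1))
proposition3p2 =
  (λ p → Jump⇒B (m^n>0 2 p) (Jump-2^p p)) ,
  (λ p a 2∤a 1<a →
     Jump⇒B (*-mono-≤ (m^n>0 2 p) (<⇒≤ 1<a)) (Jump-2^p*odd p 2∤a 1<a))
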